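{- In a heap with exponential upper bounded sets, a Delete-Min operation, excluding recursive pulling, takes worst-case $O(1)$ time and the change in the potential is $\Delta\Phi\le\ell$.
   Context: $\lg$ is the binary logarithm. The heap consists of sets $S_1,\ldots,S_\ell$ (doubly-linked lists with stored sizes) and pivots $p_2\le\cdots\le p_\ell$ ($p_1=-\infty$, $p_{\ell+1}=+\infty$) of distinct totally ordered keys, with $S_i\subseteq[p_i,p_{i+1})$, $|S_i|<3\cdot2^i$, and $\ell\le 1+\lg n$ where $n$ is the number of elements. Delete-Min: if $S_1$ is empty, first recursively pull elements into $S_1$ (excluded here); delete and return the minimum of $S_1$; then, if $\ell>1+\lg n$ for the new number $n$ of elements, concatenate $S_{\ell-1}$ and $S_\ell$ into $S_{\ell-1}$, and discard $S_\ell$ and $p_\ell$, so $\ell$ decreases by one. Potential: $\Phi=\sum_{i=1}^{\ell}(\phi^{\mathrm{insert}}_i+\phi^{\mathrm{push}}_i+\phi^{\mathrm{pull}}_i)$ with $\phi^{\mathrm{insert}}_i=\max\{0,|S_i|-5\cdot2^{i-1}\}$, $\phi^{\mathrm{push}}_i=\lfloor|S_i|/2^i\rfloor$, $\phi^{\mathrm{pull}}_i=\max\{0,2^{i-1}-\sum_{j=1}^i|S_j|\}$. -}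

module Defs where

open import Level using (Level; _⊔_)
open import Data.Nat using (ℕ; zero; suc; _+_; _*_; _∸_; _^_; _≤_; _<_; _/_)
open import Data.Nat.Properties using (_<?_)
open import Data.List using (List; []; _∷_; _++_; length; map; concat)
open import Data.List.Relation.Unary.All using (All)
open import Data.List.Relation.Unary.AllPairs using (AllPairs)
open import Data.Product using (_×_; _,_; proj₁; proj₂)
open import Data.Sum using (_⊎_)
open import Data.Maybe using (Maybe; just; nothing)
open import Data.Unit.Polymorphic using (⊤)
open import Relation.Nullary using (¬_; yes; no)
open import Relation.Binary.Bundles using (StrictTotalOrder)

φ-insert : ℕ → ℕ → ℕ
φ-insert i s = s ∸ 5 * 2 ^ (i ∸ 1)

φ-push : ℕ → ℕ → ℕ
φ-push i s = _/_ s (2 ^ i) {{Data.Nat.>-nonZero (Data.Nat.Properties.m^n>0 2 i)}}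
  where import Data.Nat.Properties

-- φ^pull_i = max{0, 2^(i-1) - (|S_1|+...+|S_i|)}, given the prefix sum t
φ-pull : ℕ → ℕ → ℕ
φ-pull i t = 2 ^ (i ∸ 1) ∸ t

-- Φ-from i acc [s_i, s_{i+1}, ...] where acc = |S_1|+...+|S_{i-1}|
Φ-from : ℕ → ℕ → List ℕ → ℕ
Φ-from i acc [] = 0
Φ-from i acc (s ∷ ss) =
  φ-insert i s + φ-push i s + φ-pull i (acc + s) + Φ-from (suc i) (acc + s) ss

Φˢ : List ℕ → ℕ
Φˢ = Φ-from 1 0

SizesOK : ℕ → List ℕ → Set
SizesOK i [] = ⊤
SizesOK i (s ∷ ss) = (s < 3 * 2 ^ i) × SizesOK (suc i) ss

module HeapOps {a ℓ₁ ℓ₂ : Level} (O : StrictTotalOrder a ℓ₁ ℓ₂) where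
  open StrictTotalOrder O renaming (Carrier to A; _<_ to _≺_; _<?_ to _≺?_)

  _≼_ : A → A → Set (ℓ₁ ⊔ ℓ₂)
  x ≼ y = (x ≺ y) ⊎ (x ≈ y)

  -- A heap: the set S_1 together with the list of (p_i , S_i), i = 2..ℓ.
  -- (Sets are lists; sizes are their lengths.)
  record Heap : Set a where
    constructor heap
    field
      first  : List A
      blocks : List (A × List A)
  open Heap public

  ℓ : Heap → ℕ
  ℓ h = suc (length (blocks h))

  sets : Heap → List (List A)
  sets h = first h ∷ map proj₂ (blocks h)

  sizes : Heap → List ℕ
  sizes h = map length (sets h)

  size : Heap → ℕ
  size h = length (concat (sets h))

  Φ : Heap → ℕ
  Φ h = Φˢ (sizes h)

  -- next pivot p_{i+1} (nothing = +∞)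
  nextPivot : List (A × List A) → Maybe A
  nextPivot [] = nothing
  nextPivot ((p , _) ∷ _) = just p

  Below : Maybe A → A → Set ℓ₂
  Below nothing  x = ⊤
  Below (just p) x = x ≺ p

  PivotLe : A → Maybe A → Set (ℓ₁ ⊔ ℓ₂)
  PivotLe p nothing  = ⊤
  PivotLe p (just q) = p ≼ q

  BlocksOK : List (A × List A) → Set (a ⊔ ℓ₁ ⊔ ℓ₂)
  BlocksOK [] = ⊤
  BlocksOK ((p , s) ∷ bs) =
    All (λ x → (p ≼ x) × Below (nextPivot bs) x) s × PivotLe p (nextPivot bs) × BlocksOK bs

  record Valid (h : Heap) : Set (a ⊔ ℓ₁ ⊔ ℓ₂) where
    field
      distinct  : AllPairs (λ x y → ¬ (x ≈ y)) (concat (sets h))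
      firstOK   : All (Below (nextPivot (blocks h))) (first h)
      blocksOK  : BlocksOK (blocks h)
      sizesOK   : SizesOK 1 (sizes h)
      levelsOK  : 2 ^ (ℓ h ∸ 1) ≤ size h                          -- ℓ ≤ 1 + lg n

  extract : A → List A → A × List A
  extract m [] = m , []
  extract m (y ∷ ys) with y ≺? m
  ... | yes _ = let r = extract y ys in proj₁ r , m ∷ proj₂ r
  ... | no  _ = let r = extract m ys in proj₁ r , y ∷ proj₂ r

  mergeB : List (A × List A) → List (A × List A)
  mergeB [] = []
  mergeB (x ∷ []) = x ∷ []
  mergeB ((p , s) ∷ (q , t) ∷ []) = (p , s ++ t) ∷ []
  mergeB (x ∷ y ∷ z ∷ zs) = x ∷ mergeB (y ∷ z ∷ zs)

  mergeLast : Heap → Heap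
  mergeLast (heap s []) = heap s []
  mergeLast (heap s ((p , t) ∷ [])) = heap (s ++ t) []
  mergeLast (heap s (b ∷ c ∷ bs)) = heap s (mergeB (b ∷ c ∷ bs))

  -- Elementary-step cost model: scanning S_1 costs |S_1| steps; unlinking
  -- the minimum from the doubly-linked list, updating the stored sizes and
  -- testing ℓ > 1 + lg n cost one step each; concatenating two
  -- doubly-linked lists costs one step.
  -- Result: (returned minimum , new heap , number of steps).
  -- The case S_1 = [] (recursive pulling) is excluded; it returns the heap unchanged.
  deleteMin : Heap → Maybe A × Heap × ℕ
  deleteMin (heap [] bs) = nothing , heap [] bs , 0
  deleteMin (heap (x ∷ xs) bs) with extract x xs
  ... | m , s₁ with heap s₁ bs
  ...   | h' with size h' <? 2 ^ (ℓ h' ∸ 1)     -- ℓ > 1 + lg n  (new n)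
  ...     | yes _ = just m , mergeLast h' , length (x ∷ xs) + 3 + 1
  ...     | no  _ = just m , h' , length (x ∷ xs) + 3

-- Removing the minimum from S₁ lowers |S₁|, so the insert and push terms of S₁ do not grow,
-- while every prefix sum drops by one, so each of the ℓ pull terms grows by at most one.
-- The merge is only triggered when n < 2^(ℓ-1): the merged set then has fewer than 2^(ℓ-1)
-- elements at index ℓ-1, so its insert and push terms vanish, and its pull term is bounded by
-- the old pull term of S_{ℓ-1}, whose prefix sum was smaller.  Scanning S₁ dominates the cost,
-- and |S₁| < 3·2¹.
module Submission where

open import Defs
open import Level using (Level)
open import Data.Nat using (ℕ; zero; suc; _+_; _*_; _∸_; _^_; _≤_; _<_; s≤s; z≤n)
open import Data.Nat.Properties
open import Data.Nat.DivMod using (m<n⇒m/n≡0; /-monoˡ-≤)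
open import Data.Nat.Tactic.RingSolver using (solve-∀)
open import Data.List using (List; []; _∷_; length; map; concat)
open import Data.Nat.ListAction using (sum)
open import Data.List.Properties using (length-map; length-++)
open import Data.Product using (_×_; _,_; proj₁; proj₂; ∃-syntax)
open import Relation.Nullary using (yes; no)
open import Relation.Binary.Bundles using (StrictTotalOrder)
open import Relation.Binary.PropositionalEquality
  using (_≡_; _≢_; refl; sym; trans; cong; cong₂; subst₂)

m∸n≤1+m∸[1+n] : ∀ m n → m ∸ n ≤ suc (m ∸ suc n)
m∸n≤1+m∸[1+n] zero    zero    = z≤n
m∸n≤1+m∸[1+n] zero    (suc n) = z≤n
m∸n≤1+m∸[1+n] (suc m) zero    = ≤-refl
m∸n≤1+m∸[1+n] (suc m) (suc n) = m∸n≤1+m∸[1+n] m n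

2^i≤5*2^[i∸1] : ∀ i → 2 ^ i ≤ 5 * 2 ^ (i ∸ 1)
2^i≤5*2^[i∸1] zero    = s≤s z≤n
2^i≤5*2^[i∸1] (suc i) = *-monoˡ-≤ (2 ^ i) {2} {5} (s≤s (s≤s z≤n))

φ-insert-mono : ∀ i {s s′} → s ≤ s′ → φ-insert i s ≤ φ-insert i s′
φ-insert-mono i = ∸-monoˡ-≤ (5 * 2 ^ (i ∸ 1))

φ-push-mono : ∀ i {s s′} → s ≤ s′ → φ-push i s ≤ φ-push i s′
φ-push-mono i = /-monoˡ-≤ (2 ^ i) {{m^n≢0 2 i}}

φ-pull-antitone : ∀ i {t t′} → t ≤ t′ → φ-pull i t′ ≤ φ-pull i t
φ-pull-antitone i = ∸-monoʳ-≤ (2 ^ (i ∸ 1))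

φ-pull-suc : ∀ i t → φ-pull i t ≤ suc (φ-pull i (suc t))
φ-pull-suc i = m∸n≤1+m∸[1+n] (2 ^ (i ∸ 1))

φ-insert-small : ∀ i {s} → s ≤ 2 ^ i → φ-insert i s ≡ 0
φ-insert-small i s≤2^i = m≤n⇒m∸n≡0 (≤-trans s≤2^i (2^i≤5*2^[i∸1] i))

φ-push-small : ∀ i {s} → s < 2 ^ i → φ-push i s ≡ 0
φ-push-small i = m<n⇒m/n≡0 {{m^n≢0 2 i}}

suc-shift : ∀ x p f n → x + suc p + (f + n) ≡ x + p + f + suc n
suc-shift = solve-∀

Φ-from-suc-acc : ∀ i acc ss → Φ-from i acc ss ≤ Φ-from i (suc acc) ss + length ss
Φ-from-suc-acc i acc []       = z≤n
Φ-from-suc-acc i acc (s ∷ ss) = begin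
  x + φ-pull i (acc + s) + Φ-from (suc i) (acc + s) ss
    ≤⟨ +-mono-≤ (+-monoʳ-≤ x (φ-pull-suc i (acc + s))) (Φ-from-suc-acc (suc i) (acc + s) ss) ⟩
  x + suc (φ-pull i (suc acc + s)) + (Φ-from (suc i) (suc acc + s) ss + length ss)
    ≡⟨ suc-shift x _ _ _ ⟩
  x + φ-pull i (suc acc + s) + Φ-from (suc i) (suc acc + s) ss + suc (length ss) ∎
  where
  open ≤-Reasoning
  x = φ-insert i s + φ-push i s

Φ-from-remove-one : ∀ i acc s ss → Φ-from i acc (s ∷ ss) ≤ Φ-from i acc (suc s ∷ ss) + length (s ∷ ss)
Φ-from-remove-one i acc s ss rewrite +-suc acc s = begin
  φ-insert i s + φ-push i s + φ-pull i (acc + s) + Φ-from (suc i) (acc + s) ss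
    ≤⟨ +-mono-≤ (+-mono-≤ (+-mono-≤ (φ-insert-mono i s≤1+s) (φ-push-mono i s≤1+s))
                          (φ-pull-suc i (acc + s)))
                (Φ-from-suc-acc (suc i) (acc + s) ss) ⟩
  y + p + suc q + (f + length ss)
    ≡⟨ suc-shift (y + p) q f (length ss) ⟩
  y + p + q + f + suc (length ss) ∎
  where
  open ≤-Reasoning
  s≤1+s = n≤1+n s
  y = φ-insert i (suc s)
  p = φ-push i (suc s)
  q = φ-pull i (suc (acc + s))
  f = Φ-from (suc i) (suc (acc + s)) ss

mergeLastTwo : List ℕ → List ℕ
mergeLastTwo []               = []
mergeLastTwo (x ∷ [])         = x ∷ []
mergeLastTwo (x ∷ y ∷ [])     = x + y ∷ []
mergeLastTwo (x ∷ y ∷ z ∷ zs) = x ∷ mergeLastTwo (y ∷ z ∷ zs)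

Φ-from-merge-pair : ∀ i acc a b → a + b < 2 ^ i →
  Φ-from i acc (a + b ∷ []) ≤ Φ-from i acc (a ∷ b ∷ [])
Φ-from-merge-pair i acc a b a+b<2^i
  rewrite φ-insert-small i (<⇒≤ a+b<2^i) | φ-push-small i a+b<2^i = begin
  φ-pull i (acc + (a + b)) + 0                  ≡⟨ +-identityʳ _ ⟩
  φ-pull i (acc + (a + b))                      ≤⟨ φ-pull-antitone i (+-monoʳ-≤ acc (m≤m+n a b)) ⟩
  φ-pull i (acc + a)                            ≤⟨ m≤n+m _ _ ⟩
  φ-insert i a + φ-push i a + φ-pull i (acc + a) ≤⟨ m≤m+n _ _ ⟩
  Φ-from i acc (a ∷ b ∷ [])                     ∎
  where open ≤-Reasoning

-- The merged set sits at index i + length ss ∸ 2.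
Φ-from-mergeLastTwo : ∀ i acc ss → sum ss < 2 ^ (i + length ss ∸ 2) →
  Φ-from i acc (mergeLastTwo ss) ≤ Φ-from i acc ss
Φ-from-mergeLastTwo i acc []               _ = ≤-refl
Φ-from-mergeLastTwo i acc (x ∷ [])         _ = ≤-refl
Φ-from-mergeLastTwo i acc (a ∷ b ∷ [])     small =
  Φ-from-merge-pair i acc a b
    (subst₂ (λ m k → m < 2 ^ k) (cong (a +_) (+-identityʳ b)) (m+n∸n≡m i 2) small)
Φ-from-mergeLastTwo i acc (x ∷ y ∷ z ∷ zs) small =
  +-monoʳ-≤ (φ-insert i x + φ-push i x + φ-pull i (acc + x))
    (Φ-from-mergeLastTwo (suc i) (acc + x) (y ∷ z ∷ zs)
      (subst₂ (λ m k → m < 2 ^ (k ∸ 2)) refl (+-suc i (length (y ∷ z ∷ zs)))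
        (≤-<-trans (m≤n+m _ x) small)))

module DeleteMin {a ℓ₁ ℓ₂ : Level} (O : StrictTotalOrder a ℓ₁ ℓ₂) where
  open HeapOps O
  open StrictTotalOrder O using () renaming (Carrier to A; _<?_ to _≺?_)

  length-extract : ∀ m ys → length (proj₂ (extract m ys)) ≡ length ys
  length-extract m []       = refl
  length-extract m (y ∷ ys) with y ≺? m
  ... | yes _ = cong suc (length-extract y ys)
  ... | no  _ = cong suc (length-extract m ys)

  length-sizes : ∀ h → length (sizes h) ≡ ℓ h
  length-sizes h = cong suc (trans (length-map length (map proj₂ (blocks h)))
                                   (length-map proj₂ (blocks h)))

  size≡sum-sizes : ∀ h → size h ≡ sum (sizes h)
  size≡sum-sizes h = length-concat (sets h)
    where
    length-concat : ∀ (xss : List (List A)) → length (concat xss) ≡ sum (map length xss)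
    length-concat []         = refl
    length-concat (xs ∷ xss) = trans (length-++ xs) (cong (length xs +_) (length-concat xss))

  sizes-mergeB : ∀ (bs : List (A × List A)) →
    map length (map proj₂ (mergeB bs)) ≡ mergeLastTwo (map length (map proj₂ bs))
  sizes-mergeB []                          = refl
  sizes-mergeB (_ ∷ [])                    = refl
  sizes-mergeB ((_ , s) ∷ (_ , t) ∷ [])    = cong (_∷ []) (length-++ s)
  sizes-mergeB ((_ , s) ∷ b ∷ c ∷ bs)      = cong (length s ∷_) (sizes-mergeB (b ∷ c ∷ bs))

  sizes-mergeLast : ∀ h → sizes (mergeLast h) ≡ mergeLastTwo (sizes h)
  sizes-mergeLast (heap s [])               = refl
  sizes-mergeLast (heap s ((_ , t) ∷ []))   = cong (_∷ []) (length-++ s)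
  sizes-mergeLast (heap s (b ∷ c ∷ bs))     = cong (length s ∷_) (sizes-mergeB (b ∷ c ∷ bs))

  Φ-mergeLast : ∀ h → size h < 2 ^ (ℓ h ∸ 1) → Φ (mergeLast h) ≤ Φ h
  Φ-mergeLast h small = subst₂ _≤_ (cong Φˢ (sym (sizes-mergeLast h))) refl
    (Φ-from-mergeLastTwo 1 0 (sizes h)
      (subst₂ (λ m k → m < 2 ^ (suc k ∸ 2)) (size≡sum-sizes h) (sym (length-sizes h)) small))

  Φ-remove-from-first : ∀ (s s′ : List A) bs → length s′ ≡ suc (length s) →
    Φ (heap s bs) ≤ Φ (heap s′ bs) + ℓ (heap s′ bs)
  Φ-remove-from-first s s′ bs s′≡1+s = begin
    Φˢ (length s ∷ L)                          ≤⟨ Φ-from-remove-one 1 0 (length s) L ⟩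
    Φˢ (suc (length s) ∷ L) + length (sizes h) ≡⟨ cong₂ (λ k m → Φˢ (k ∷ L) + m)
                                                        (sym s′≡1+s) (length-sizes h) ⟩
    Φˢ (sizes (heap s′ bs)) + ℓ h              ∎
    where
    open ≤-Reasoning
    h = heap s bs
    L = map length (map proj₂ bs)

  deleteMin-cost : ∀ h → proj₂ (proj₂ (deleteMin h)) ≤ length (first h) + 4
  deleteMin-cost (heap [] bs) = z≤n
  deleteMin-cost (heap (x ∷ xs) bs) with extract x xs
  ... | _ , s₁ with size (heap s₁ bs) <? 2 ^ (ℓ (heap s₁ bs) ∸ 1)
  ... | yes _ = ≤-reflexive (+-assoc (length (x ∷ xs)) 3 1)
  ... | no  _ = +-monoʳ-≤ (length (x ∷ xs)) (n≤1+n 3)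

  deleteMin-Φ : ∀ h → Φ (proj₁ (proj₂ (deleteMin h))) ≤ Φ h + ℓ h
  deleteMin-Φ (heap [] bs) = m≤m+n _ _
  deleteMin-Φ (heap (x ∷ xs) bs) with extract x xs | length-extract x xs
  ... | _ , s₁ | s₁≡xs with size (heap s₁ bs) <? 2 ^ (ℓ (heap s₁ bs) ∸ 1)
  ... | yes small = ≤-trans (Φ-mergeLast (heap s₁ bs) small)
                            (Φ-remove-from-first s₁ (x ∷ xs) bs (cong suc (sym s₁≡xs)))
  ... | no  _     = Φ-remove-from-first s₁ (x ∷ xs) bs (cong suc (sym s₁≡xs))

  length-first≤5 : ∀ {h} → Valid h → length (first h) ≤ 5
  length-first≤5 v = ≤-pred (proj₁ (Valid.sizesOK v))

lemma15 : ∀ {a ℓ₁ ℓ₂ : Level} (O : StrictTotalOrder a ℓ₁ ℓ₂) →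
    let open HeapOps O in
    ∃[ c ] (∀ (h : Heap) → Valid h → first h ≢ [] →
      (proj₂ (proj₂ (deleteMin h)) ≤ c)
      × (Φ (proj₁ (proj₂ (deleteMin h))) ≤ Φ h + ℓ h))
lemma15 O = 9 , λ h valid _ →
  ≤-trans (deleteMin-cost h) (+-monoˡ-≤ 4 (length-first≤5 valid)) , deleteMin-Φ h
  where open DeleteMin O
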